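{- Let $h:\{0,1\}^k\to\{ -1,0,1\}$ have a representation as a multilinear polynomial of degree $k$, and let $1/c_h(k)$ be the coefficient of the monomial $\delta_1\cdots\delta_k$ in it. Let $T_{(1)},\dots,T_{(k)},T'_{(1)},\dots,T'_{(k)}$ be $2k$ matrices with $\{0,1\}$ entries and dimensions $d\times n$. For $I\subseteq[k]$ let $T_{(j)}(I)=T'_{(j)}$ if $j\in I$ and $T_{(j)}(I)=T_{(j)}$ if $j\notin I$. Then $$(T_{(1)}-T'_{(1)})\odot\cdots\odot(T_{(k)}-T'_{(k)})=c_h(k)\sum_{I\subseteq[k]}(-1)^{|I|}\,\Pi_h\big(T_{(1)}(I),\dots,T_{(k)}(I)\big).$$
   Context: Row function matrix: for $h:\{0,1\}^k\to\{ -1,0,1\}$ and $d\times n$ matrices $T_{(1)}=(\delta^{(1)}_{i,j}),\dots,T_{(k)}=(\delta^{(k)}_{i,j})$, $\Pi_h(T_{(1)},\dots,T_{(k)})$ is the $d^k\times n$ matrix with rows indexed by $J=(j_1,\dots,j_k)\in\{1,\dots,d\}^k$ and entries $\pi_{J,a}=h(\delta^{(1)}_{j_1,a},\dots,\delta^{(k)}_{j_k,a})$, $a\in\{1,\dots,n\}$. Row product: for $N_1\times n$ matrix $A$ and $N_2\times n$ matrix $B$, $A\odot B$ is the $N_1N_2\times n$ matrix whose row indexed by $(j,l)$ is the entrywise product of row $j$ of $A$ and row $l$ of $B$; for $k$ matrices the rows of $A_1\odot\cdots\odot A_k$ are indexed by $(j_1,\dots,j_k)$, in the same order as the rows of $\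Pi_h$.
   Formalization: The coefficients of the multilinear polynomial representing h, and the number $c_h(k)$, are rational rather than real. -}

module Defs where

open import Data.Nat using (ℕ; zero; suc)
open import Data.Integer using (ℤ; +_; -[1+_])
open import Data.Bool using (Bool; true; false; if_then_else_)
open import Data.Fin using (Fin; zero; suc)
open import Data.Fin.Subset using (Subset; inside; outside; ⊤; ∣_∣)
open import Data.Vec using (Vec; []; _∷_; lookup)
open import Data.Rational using (ℚ; 0ℚ; 1ℚ; _+_; _*_; _-_; -_; _/_)
open import Data.Sum using (_⊎_)
open import Relation.Binary.PropositionalEquality using (_≡_)

ℤ→ℚ : ℤ → ℚ
ℤ→ℚ z = z / 1

bit : Bool → ℚ
bit b = if b then 1ℚ else 0ℚ

ΣFin : ∀ k → (Fin k → ℚ) → ℚ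
ΣFin zero    f = 0ℚ
ΣFin (suc k) f = f zero + ΣFin k (λ i → f (suc i))

ΠFin : ∀ k → (Fin k → ℚ) → ℚ
ΠFin zero    f = 1ℚ
ΠFin (suc k) f = f zero * ΠFin k (λ i → f (suc i))

ΣSubset : ∀ k → (Subset k → ℚ) → ℚ
ΣSubset zero    f = f []
ΣSubset (suc k) f = ΣSubset k (λ I → f (outside ∷ I)) + ΣSubset k (λ I → f (inside ∷ I))

sgn : ℕ → ℚ
sgn zero    = 1ℚ
sgn (suc m) = - sgn m

Valued±1,0 : ∀ {k} → ((Fin k → Bool) → ℤ) → Set
Valued±1,0 h = ∀ x → (h x ≡ -[1+ 0 ]) ⊎ (h x ≡ + 0) ⊎ (h x ≡ + 1)

monomial : ∀ k → Subset k → (Fin k → Bool) → ℚ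
monomial k S x = ΠFin k (λ i → if lookup S i then bit (x i) else 1ℚ)

IsMultilinearRep : ∀ k → ((Fin k → Bool) → ℤ) → (Subset k → ℚ) → Set
IsMultilinearRep k h c = ∀ x → ℤ→ℚ (h x) ≡ ΣSubset k (λ S → c S * monomial k S x)

Matrix : Set → ℕ → ℕ → Set
Matrix A N n = Fin N → Fin n → A

-- Row function matrix Π_h(T₁,…,T_k); rows indexed by J = (j₁,…,j_k) : Fin k → Fin d
RowIdx : ℕ → ℕ → Set
RowIdx k d = Fin k → Fin d

Πh : ∀ {k d n} → ((Fin k → Bool) → ℤ) → (Fin k → Matrix Bool d n) → RowIdx k d → Fin n → ℚ
Πh h T J a = ℤ→ℚ (h (λ i → T i (J i) a))

rowProd : ∀ {k d n} → (Fin k → Matrix ℚ d n) → RowIdx k d → Fin n → ℚ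
rowProd {k} A J a = ΠFin k (λ i → A i (J i) a)

replaceBy : ∀ {k d n} → (T T' : Fin k → Matrix Bool d n) → Subset k → Fin k → Matrix Bool d n
replaceBy T T' I j = if lookup I j then T' j else T j

diffM : ∀ {d n} → Matrix Bool d n → Matrix Bool d n → Matrix ℚ d n
diffM T T' j a = bit (T j a) - bit (T' j a)

module Submission where

-- Expand h in its multilinear representation and exchange the sums over I and S.
-- For a fixed monomial δ_S the alternating sum over I expands the product
-- ∏_{i∈S} (δ_i − δ'_i) ∏_{i∉S} (1 − 1), which vanishes unless S = [k];
-- only the top coefficient c_[k] = 1 / c_h(k) survives.

open import Defs
open import Data.Nat using (ℕ; zero; suc)
open import Data.Integer using (ℤ)
open import Data.Bool using (Bool; true; false; if_then_else_)
open import Data.Fin using (Fin; zero; suc)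
open import Data.Fin.Subset using (Subset; ⊤; ∣_∣; inside; outside)
open import Data.Vec using ([]; _∷_; lookup)
open import Data.Rational using (ℚ; 0ℚ; 1ℚ; _*_; _+_; _-_; -_)
open import Data.Rational.Properties
  using (*-assoc; *-identityˡ; *-zeroˡ; *-zeroʳ; +-identityˡ; *-distribˡ-+; *-distribʳ-+;
         neg-distribˡ-*; *-1-commutativeMonoid; +-0-commutativeMonoid)
open import Algebra.Bundles using (CommutativeMonoid)
open import Algebra.Properties.CommutativeSemigroup
  (CommutativeMonoid.commutativeSemigroup *-1-commutativeMonoid) using (x∙yz≈y∙xz)
open import Algebra.Properties.CommutativeSemigroup
  (CommutativeMonoid.commutativeSemigroup +-0-commutativeMonoid) using (interchange)
open import Relation.Binary.PropositionalEquality
  using (_≡_; refl; sym; trans; cong; cong₂; module ≡-Reasoning)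

pick : ∀ {k} {A : Set} → Subset k → (Fin k → A) → (Fin k → A) → Fin k → A
pick I v u i = if lookup I i then v i else u i

ΣSubset-cong : ∀ k {f g : Subset k → ℚ} → (∀ I → f I ≡ g I) → ΣSubset k f ≡ ΣSubset k g
ΣSubset-cong zero    f≡g = f≡g []
ΣSubset-cong (suc k) f≡g =
  cong₂ _+_ (ΣSubset-cong k (λ I → f≡g (outside ∷ I))) (ΣSubset-cong k (λ I → f≡g (inside ∷ I)))

ΠFin-cong : ∀ k {f g : Fin k → ℚ} → (∀ i → f i ≡ g i) → ΠFin k f ≡ ΠFin k g
ΠFin-cong zero    f≡g = refl
ΠFin-cong (suc k) f≡g = cong₂ _*_ (f≡g zero) (ΠFin-cong k (λ i → f≡g (suc i)))

ΣSubset-0 : ∀ k → ΣSubset k (λ _ → 0ℚ) ≡ 0ℚ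
ΣSubset-0 zero    = refl
ΣSubset-0 (suc k) = cong₂ _+_ (ΣSubset-0 k) (ΣSubset-0 k)

ΣSubset-+ : ∀ k (f g : Subset k → ℚ) →
  ΣSubset k (λ I → f I + g I) ≡ ΣSubset k f + ΣSubset k g
ΣSubset-+ zero    f g = refl
ΣSubset-+ (suc k) f g =
  trans (cong₂ _+_ (ΣSubset-+ k (λ I → f (outside ∷ I)) (λ I → g (outside ∷ I)))
                   (ΣSubset-+ k (λ I → f (inside ∷ I)) (λ I → g (inside ∷ I))))
    (interchange (ΣSubset k (λ I → f (outside ∷ I))) (ΣSubset k (λ I → g (outside ∷ I)))
                 (ΣSubset k (λ I → f (inside ∷ I))) (ΣSubset k (λ I → g (inside ∷ I))))

*-distribˡ-ΣSubset : ∀ k (r : ℚ) (f : Subset k → ℚ) →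
  ΣSubset k (λ I → r * f I) ≡ r * ΣSubset k f
*-distribˡ-ΣSubset zero    r f = refl
*-distribˡ-ΣSubset (suc k) r f =
  trans (cong₂ _+_ (*-distribˡ-ΣSubset k r _) (*-distribˡ-ΣSubset k r _))
    (sym (*-distribˡ-+ r _ _))

ΣSubset-swap : ∀ k m (F : Subset k → Subset m → ℚ) →
  ΣSubset k (λ I → ΣSubset m (F I)) ≡ ΣSubset m (λ S → ΣSubset k (λ I → F I S))
ΣSubset-swap zero    m F = refl
ΣSubset-swap (suc k) m F =
  trans (cong₂ _+_ (ΣSubset-swap k m _) (ΣSubset-swap k m _))
    (sym (ΣSubset-+ m _ _))

ΣSubset-alternating-ΠFin : ∀ k (u v : Fin k → ℚ) →
  ΣSubset k (λ I → sgn ∣ I ∣ * ΠFin k (pick I v u)) ≡ ΠFin k (λ i → u i - v i)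
ΣSubset-alternating-ΠFin zero    u v = refl
ΣSubset-alternating-ΠFin (suc k) u v = begin
    ΣSubset k (λ I → sgn ∣ I ∣ * (u zero * P I)) + ΣSubset k (λ I → - sgn ∣ I ∣ * (v zero * P I))
  ≡⟨ cong₂ _+_
       (trans (ΣSubset-cong k (λ I → x∙yz≈y∙xz (sgn ∣ I ∣) (u zero) (P I)))
              (*-distribˡ-ΣSubset k (u zero) _))
       (trans (ΣSubset-cong k (λ I → neg-x∙yz≈-y∙xz (sgn ∣ I ∣) (v zero) (P I)))
              (*-distribˡ-ΣSubset k (- v zero) _)) ⟩
    u zero * G + - v zero * G
  ≡⟨ sym (*-distribʳ-+ G (u zero) (- v zero)) ⟩
    (u zero - v zero) * G
  ≡⟨ cong ((u zero - v zero) *_) (ΣSubset-alternating-ΠFin k (λ i → u (suc i)) (λ i → v (suc i))) ⟩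
    ΠFin (suc k) (λ i → u i - v i)
  ∎
  where
  open ≡-Reasoning
  P : Subset k → ℚ
  P I = ΠFin k (pick I (λ i → v (suc i)) (λ i → u (suc i)))
  G : ℚ
  G = ΣSubset k (λ I → sgn ∣ I ∣ * P I)
  neg-x∙yz≈-y∙xz : ∀ x y z → - x * (y * z) ≡ - y * (x * z)
  neg-x∙yz≈-y∙xz x y z = trans (sym (neg-distribˡ-* x _))
    (trans (cong -_ (x∙yz≈y∙xz x y z)) (neg-distribˡ-* y _))

ΣSubset-alternating-monomial : ∀ k (S : Subset k) (b b' : Fin k → Bool) →
  ΣSubset k (λ I → sgn ∣ I ∣ * monomial k S (pick I b' b))
  ≡ ΠFin k (pick S (λ i → bit (b i) - bit (b' i)) (λ _ → 0ℚ))
ΣSubset-alternating-monomial k S b b' =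
  trans (ΣSubset-cong k (λ I → cong (sgn ∣ I ∣ *_) (ΠFin-cong k (monomial-factor I))))
    (trans (ΣSubset-alternating-ΠFin k (factor b) (factor b'))
      (ΠFin-cong k factor-difference))
  where
  factor : (Fin k → Bool) → Fin k → ℚ
  factor x = pick S (λ i → bit (x i)) (λ _ → 1ℚ)

  monomial-factor : ∀ I i →
    pick S (λ j → bit (pick I b' b j)) (λ _ → 1ℚ) i ≡ pick I (factor b') (factor b) i
  monomial-factor I i with lookup I i
  ... | true  = refl
  ... | false = refl

  factor-difference : ∀ i →
    factor b i - factor b' i ≡ pick S (λ j → bit (b j) - bit (b' j)) (λ _ → 0ℚ) i
  factor-difference i with lookup S i
  ... | true  = refl
  ... | false = refl

ΣSubset-masked-ΠFin : ∀ k (g : Subset k → ℚ) (e : Fin k → ℚ) →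
  ΣSubset k (λ S → g S * ΠFin k (pick S e (λ _ → 0ℚ))) ≡ g ⊤ * ΠFin k e
ΣSubset-masked-ΠFin zero    g e = refl
ΣSubset-masked-ΠFin (suc k) g e = begin
    ΣSubset k (λ S → g (outside ∷ S) * (0ℚ * Q S)) + ΣSubset k (λ S → g (inside ∷ S) * (e zero * Q S))
  ≡⟨ cong₂ _+_
       (trans (ΣSubset-cong k (λ S → trans (cong (g (outside ∷ S) *_) (*-zeroˡ (Q S))) (*-zeroʳ (g (outside ∷ S)))))
              (ΣSubset-0 k))
       (trans (ΣSubset-cong k (λ S → x∙yz≈y∙xz (g (inside ∷ S)) (e zero) (Q S)))
              (trans (*-distribˡ-ΣSubset k (e zero) _)
                     (cong (e zero *_) (ΣSubset-masked-ΠFin k (λ S → g (inside ∷ S)) (λ i → e (suc i)))))) ⟩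
    0ℚ + e zero * (g ⊤ * ΠFin k (λ i → e (suc i)))
  ≡⟨ trans (+-identityˡ _) (x∙yz≈y∙xz (e zero) (g ⊤) _) ⟩
    g ⊤ * ΠFin (suc k) e
  ∎
  where
  open ≡-Reasoning
  Q : Subset k → ℚ
  Q S = ΠFin k (pick S (λ i → e (suc i)) (λ _ → 0ℚ))

ΣSubset-alternating-multilinear : ∀ k (c : Subset k → ℚ) (b b' : Fin k → Bool) →
  ΣSubset k (λ I → sgn ∣ I ∣ * ΣSubset k (λ S → c S * monomial k S (pick I b' b)))
  ≡ c ⊤ * ΠFin k (λ i → bit (b i) - bit (b' i))
ΣSubset-alternating-multilinear k c b b' = begin
    ΣSubset k (λ I → sgn ∣ I ∣ * ΣSubset k (λ S → c S * m I S))
  ≡⟨ ΣSubset-cong k (λ I → sym (*-distribˡ-ΣSubset k (sgn ∣ I ∣) _)) ⟩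
    ΣSubset k (λ I → ΣSubset k (λ S → sgn ∣ I ∣ * (c S * m I S)))
  ≡⟨ ΣSubset-swap k k _ ⟩
    ΣSubset k (λ S → ΣSubset k (λ I → sgn ∣ I ∣ * (c S * m I S)))
  ≡⟨ ΣSubset-cong k (λ S → trans
       (ΣSubset-cong k (λ I → x∙yz≈y∙xz (sgn ∣ I ∣) (c S) (m I S)))
       (*-distribˡ-ΣSubset k (c S) _)) ⟩
    ΣSubset k (λ S → c S * ΣSubset k (λ I → sgn ∣ I ∣ * m I S))
  ≡⟨ ΣSubset-cong k (λ S → cong (c S *_) (ΣSubset-alternating-monomial k S b b')) ⟩
    ΣSubset k (λ S → c S * ΠFin k (pick S (λ i → bit (b i) - bit (b' i)) (λ _ → 0ℚ)))
  ≡⟨ ΣSubset-masked-ΠFin k c _ ⟩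
    c ⊤ * ΠFin k (λ i → bit (b i) - bit (b' i))
  ∎
  where
  open ≡-Reasoning
  m : Subset k → Subset k → ℚ
  m I S = monomial k S (pick I b' b)

monomial-replaceBy : ∀ {k d n} (S : Subset k) (T T' : Fin k → Matrix Bool d n) (I : Subset k)
  (J : RowIdx k d) (a : Fin n) →
  monomial k S (λ i → replaceBy T T' I i (J i) a)
  ≡ monomial k S (pick I (λ i → T' i (J i) a) (λ i → T i (J i) a))
monomial-replaceBy {k} S T T' I J a = ΠFin-cong k entry
  where
  entry : ∀ i → (if lookup S i then bit (replaceBy T T' I i (J i) a) else 1ℚ)
              ≡ (if lookup S i then bit (pick I (λ j → T' j (J j) a) (λ j → T j (J j) a) i) else 1ℚ)
  entry i with lookup I i
  ... | true  = refl
  ... | false = refl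

-- The hypothesis that h takes values in {-1,0,1} is not needed: the identity
-- holds for any h with a multilinear representation whose top coefficient is invertible.
corollary3p13 :
    (k d n : ℕ) (h : (Fin k → Bool) → ℤ) → Valued±1,0 h →
    (c : Subset k → ℚ) → IsMultilinearRep k h c →
    (ch : ℚ) → c ⊤ * ch ≡ 1ℚ →
    (T T' : Fin k → Matrix Bool d n) →
    (J : RowIdx k d) (a : Fin n) →
    rowProd (λ i → diffM (T i) (T' i)) J a
      ≡ ch * ΣSubset k (λ I → sgn ∣ I ∣ * Πh h (replaceBy T T' I) J a)
corollary3p13 k d n h _ c rep ch c⊤*ch≡1 T T' J a = sym (begin
    ch * ΣSubset k (λ I → sgn ∣ I ∣ * Πh h (replaceBy T T' I) J a)
  ≡⟨ cong (ch *_) (ΣSubset-cong k (λ I → cong (sgn ∣ I ∣ *_) (trans (rep _)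
       (ΣSubset-cong k (λ S → cong (c S *_) (monomial-replaceBy S T T' I J a)))))) ⟩
    ch * ΣSubset k (λ I → sgn ∣ I ∣ * ΣSubset k (λ S → c S * monomial k S (pick I b' b)))
  ≡⟨ cong (ch *_) (ΣSubset-alternating-multilinear k c b b') ⟩
    ch * (c ⊤ * D)
  ≡⟨ trans (x∙yz≈y∙xz ch (c ⊤) D) (sym (*-assoc (c ⊤) ch D)) ⟩
    (c ⊤ * ch) * D
  ≡⟨ cong (_* D) c⊤*ch≡1 ⟩
    1ℚ * D
  ≡⟨ *-identityˡ D ⟩
    D
  ∎)
  where
  open ≡-Reasoning
  b b' : Fin k → Bool
  b  i = T i (J i) a
  b' i = T' i (J i) a
  D : ℚ
  D = ΠFin k (λ i → bit (b i) - bit (b' i))
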